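{- Let $a\ge1$ be an integer and $m\ge 2$ an even integer. Then for every nonnegative integer $n$, $\mathrm{cp}_{a,a,m}(2n+1)\equiv 0\pmod 2$.
   Context: For integers $a,b,m\ge1$, an $(a,b,m)$-copartition is a triple of integer partitions $(\gamma,\rho,\sigma)$ such that every part of $\gamma$ is $\ge a$ and $\equiv a \pmod m$, every part of $\sigma$ is $\ge b$ and $\equiv b\pmod m$, and $\rho$ has exactly as many parts as $\sigma$, each part of $\rho$ being equal to $m$ times the number of parts of $\gamma$. Its size is the sum of all parts of $\gamma,\rho,\sigma$, and $\mathrm{cp}_{a,b,m}(n)$ denotes the number of $(a,b,m)$-copartitions of size $n$. -}

module Defs where

open import Data.Nat using (ℕ; _+_; _*_; _∸_; _≤_; _≥_)
open import Data.Nat.Divisibility using (_∣_)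
open import Data.List using (List; length)
open import Data.Nat.ListAction using (sum)
open import Data.List.Relation.Unary.All using (All)
open import Data.List.Relation.Unary.Linked using (Linked)
open import Data.List.Relation.Unary.Unique.Propositional using (Unique)
open import Data.List.Membership.Propositional using (_∈_)
open import Data.Product using (_×_; Σ; ∃; _,_)
open import Function.Bundles using (_⇔_)
open import Relation.Binary.PropositionalEquality using (_≡_)

IsPartition : List ℕ → Set
IsPartition λs = Linked _≥_ λs × All (1 ≤_) λs

Admissible : ℕ → ℕ → ℕ → Set
Admissible c m p = c ≤ p × m ∣ (p ∸ c)

Triple : Set
Triple = List ℕ × List ℕ × List ℕ

-- (γ, ρ, σ) is an (a,b,m)-copartition.
-- ρ has exactly as many parts as σ, each equal to m * (number of parts of γ)
-- (these parts may be 0 when γ is empty).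
IsCopartition : ℕ → ℕ → ℕ → Triple → Set
IsCopartition a b m (γ , ρ , σ) =
  IsPartition γ × All (Admissible a m) γ ×
  IsPartition σ × All (Admissible b m) σ ×
  length ρ ≡ length σ × All (_≡ m * length γ) ρ

size : Triple → ℕ
size (γ , ρ , σ) = sum γ + sum ρ + sum σ

IsCp : ℕ → ℕ → ℕ → ℕ → ℕ → Set
IsCp a b m n k =
  Σ (List Triple) λ L →
    Unique L ×
    (∀ x → (x ∈ L) ⇔ (IsCopartition a b m x × size x ≡ n)) ×
    length L ≡ k

{-# OPTIONS --safe #-}
-- Exchanging γ and σ (and rebuilding ρ) is a size-preserving involution on
-- (a,a,m)-copartitions. A fixed point has σ = γ, so its size is 2·Σγ + m·ℓ(γ)², which is
-- even when m is. At odd sizes the involution is therefore fixed-point free, and the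
-- copartitions of that size split into pairs.
module Submission where

open import Defs
open import Data.Nat using (ℕ; zero; suc; _+_; _*_; _≤_; s≤s; z≤n)
open import Data.Nat.Divisibility
  using (_∣_; divides; m∣m*n; ∣m⇒∣m*n; ∣n⇒∣m*n; ∣m∣n⇒∣m+n; ∣m+n∣m⇒∣n; >⇒∤)
open import Data.Nat.Properties using (suc-injective)
open import Data.Nat.ListAction using (sum)
open import Data.Nat.Tactic.RingSolver using (solve-∀)
open import Data.List using (List; []; _∷_; length; replicate)
open import Data.List.Properties using (length-removeAt′; length-replicate)
open import Data.List.Relation.Unary.All using (All; []; _∷_; lookup)
open import Data.List.Relation.Unary.All.Properties using (─⁺; replicate⁺)
open import Data.List.Relation.Unary.Any using (here; there; _─_; index)
open import Data.List.Relation.Unary.AllPairs using (_∷_)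
open import Data.List.Relation.Unary.Unique.Propositional using (Unique)
open import Data.List.Membership.Propositional using (_∈_)
open import Data.Product using (_×_; Σ; _,_; proj₁; proj₂)
open import Function.Bundles using (Equivalence)
open import Relation.Binary.PropositionalEquality
  using (_≡_; _≢_; refl; sym; trans; cong; subst; ≢-sym; module ≡-Reasoning)
open import Relation.Nullary using (¬_; contradiction)

module _ {A : Set} where

  ∈-─⁻ : ∀ {y z : A} {xs} (p : y ∈ xs) → z ∈ (xs ─ p) → z ∈ xs
  ∈-─⁻ (here _)  q         = there q
  ∈-─⁻ (there p) (here e)  = here e
  ∈-─⁻ (there p) (there q) = there (∈-─⁻ p q)

  ∈-─⁺ : ∀ {y z : A} {xs} (p : y ∈ xs) → z ∈ xs → z ≢ y → z ∈ (xs ─ p)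
  ∈-─⁺ (here refl) (here refl) z≢y = contradiction refl z≢y
  ∈-─⁺ (here _)    (there q)   _   = q
  ∈-─⁺ (there p)   (here e)    _   = here e
  ∈-─⁺ (there p)   (there q)   z≢y = there (∈-─⁺ p q z≢y)

  Unique-─ : ∀ {y : A} {xs} (p : y ∈ xs) → Unique xs → Unique (xs ─ p)
  Unique-─ (here _)  (_ ∷ u)     = u
  Unique-─ (there p) (x≢xs ∷ u) = ─⁺ p x≢xs ∷ Unique-─ p u

  Unique⇒∈-─⇒≢ : ∀ {y z : A} {xs} (p : y ∈ xs) → Unique xs → z ∈ (xs ─ p) → z ≢ y
  Unique⇒∈-─⇒≢ (here refl) (y≢xs ∷ _) q         = ≢-sym (lookup y≢xs q)
  Unique⇒∈-─⇒≢ (there p)   (x≢xs ∷ _) (here refl) = lookup x≢xs p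
  Unique⇒∈-─⇒≢ (there p)   (_ ∷ u)    (there q)   = Unique⇒∈-─⇒≢ p u q

  record IsFixedPointFreeInvolutionOn (f : A → A) (L : List A) : Set where
    field
      closed         : ∀ {y} → y ∈ L → f y ∈ L
      involutive     : ∀ {y} → y ∈ L → f (f y) ≡ y
      fixedPointFree : ∀ {y} → y ∈ L → f y ≢ y

    injective : ∀ {y z} → y ∈ L → z ∈ L → f y ≡ f z → y ≡ z
    injective {y} {z} y∈L z∈L fy≡fz = begin
      y         ≡⟨ sym (involutive y∈L) ⟩
      f (f y)   ≡⟨ cong f fy≡fz ⟩
      f (f z)   ≡⟨ involutive z∈L ⟩
      z         ∎
      where open ≡-Reasoning

  open IsFixedPointFreeInvolutionOn

  removeOrbit : ∀ {f} {x : A} {xs} → Unique (x ∷ xs) → IsFixedPointFreeInvolutionOn f (x ∷ xs) →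
    Σ (List A) λ ys → length xs ≡ suc (length ys) × Unique ys × IsFixedPointFreeInvolutionOn f ys
  removeOrbit {f} {x} {xs} (x≢xs ∷ uxs) inv =
    (xs ─ fx∈xs) , length-removeAt′ xs (index fx∈xs) , Unique-─ fx∈xs uxs , record
      { closed         = closed′
      ; involutive     = λ q → involutive inv (∈L q)
      ; fixedPointFree = λ q → fixedPointFree inv (∈L q)
      }
    where
    fx∈xs : f x ∈ xs
    fx∈xs with closed inv (here refl)
    ... | here fx≡x = contradiction fx≡x (fixedPointFree inv (here refl))
    ... | there q   = q

    ∈L : ∀ {y} → y ∈ (xs ─ fx∈xs) → y ∈ x ∷ xs
    ∈L q = there (∈-─⁻ fx∈xs q)

    closed′ : ∀ {y} → y ∈ (xs ─ fx∈xs) → f y ∈ (xs ─ fx∈xs)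
    closed′ q with closed inv (∈L q)
    ... | here fy≡x = contradiction
            (injective inv (∈L q) (there fx∈xs) (trans fy≡x (sym (involutive inv (here refl)))))
            (Unique⇒∈-─⇒≢ fx∈xs uxs q)
    ... | there r   = ∈-─⁺ fx∈xs r λ fy≡fx →
            lookup x≢xs (∈-─⁻ fx∈xs q) (sym (injective inv (∈L q) (here refl) fy≡fx))

  fixedPointFreeInvolution⇒even-length : ∀ {f} {L : List A} → Unique L →
    IsFixedPointFreeInvolutionOn f L → 2 ∣ length L
  fixedPointFreeInvolution⇒even-length {f} = go _ _ refl
    where
    go : ∀ n L → length L ≡ n → Unique L → IsFixedPointFreeInvolutionOn f L → 2 ∣ n
    go zero    []       _   _ _   = divides 0 refl
    go (suc n) (x ∷ xs) len u inv with removeOrbit u inv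
    ... | ys , |xs|≡1+|ys| , uys , invys with n | trans (sym |xs|≡1+|ys|) (suc-injective len)
    ...   | suc n′ | 1+|ys|≡1+n′ with go n′ ys (suc-injective 1+|ys|≡1+n′) uys invys
    ...     | divides q n′≡q*2 = divides (suc q) (cong (λ t → suc (suc t)) n′≡q*2)

All≡⇒replicate : ∀ {A : Set} {c : A} xs → All (_≡ c) xs → xs ≡ replicate (length xs) c
All≡⇒replicate []       []          = refl
All≡⇒replicate (_ ∷ xs) (refl ∷ ps) = cong (_ ∷_) (All≡⇒replicate xs ps)

sum-replicate : ∀ k c → sum (replicate k c) ≡ k * c
sum-replicate zero    c = refl
sum-replicate (suc k) c = cong (c +_) (sum-replicate k c)

¬2∣2n+1 : ∀ n → ¬ 2 ∣ 2 * n + 1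
¬2∣2n+1 n 2∣2n+1 = >⇒∤ (s≤s (s≤s z≤n)) (∣m+n∣m⇒∣n 2∣2n+1 (m∣m*n n))

swap : ℕ → Triple → Triple
swap m (γ , ρ , σ) = σ , replicate (length γ) (m * length σ) , γ

module _ {a b m : ℕ} {γ ρ σ : List ℕ} (cp : IsCopartition a b m (γ , ρ , σ)) where

  ρ≡replicate : ρ ≡ replicate (length σ) (m * length γ)
  ρ≡replicate =
    let _ , _ , _ , _ , |ρ|≡|σ| , ρ≡m|γ| = cp in
    trans (All≡⇒replicate ρ ρ≡m|γ|) (cong (λ k → replicate k (m * length γ)) |ρ|≡|σ|)

  size-copartition : size (γ , ρ , σ) ≡ sum γ + length σ * (m * length γ) + sum σ
  size-copartition = cong (λ r → sum γ + r + sum σ)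
    (trans (cong sum ρ≡replicate) (sum-replicate (length σ) (m * length γ)))

  swap-copartition : IsCopartition b a m (swap m (γ , ρ , σ))
  swap-copartition =
    let pγ , aγ , pσ , aσ , _ = cp in
    pσ , aσ , pγ , aγ , length-replicate (length γ) , replicate⁺ (length γ) refl

  size-swap : size (swap m (γ , ρ , σ)) ≡ size (γ , ρ , σ)
  size-swap = begin
    sum σ + sum (replicate |γ| (m * |σ|)) + sum γ
      ≡⟨ cong (λ r → sum σ + r + sum γ) (sum-replicate |γ| (m * |σ|)) ⟩
    sum σ + |γ| * (m * |σ|) + sum γ
      ≡⟨ exchange (sum σ) (sum γ) |σ| |γ| m ⟩
    sum γ + |σ| * (m * |γ|) + sum σ
      ≡⟨ size-copartition ⟨
    size (γ , ρ , σ)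
      ∎
    where
    open ≡-Reasoning
    |γ| |σ| : ℕ
    |γ| = length γ
    |σ| = length σ
    exchange : ∀ s g k l c → s + l * (c * k) + g ≡ g + k * (c * l) + s
    exchange = solve-∀

  swap-involutive : swap m (swap m (γ , ρ , σ)) ≡ (γ , ρ , σ)
  swap-involutive = cong (λ r → γ , r , σ) (sym ρ≡replicate)

  swap-fixed⇒even-size : 2 ∣ m → swap m (γ , ρ , σ) ≡ (γ , ρ , σ) → 2 ∣ size (γ , ρ , σ)
  swap-fixed⇒even-size 2∣m fixed with cong proj₁ fixed
  ... | refl = subst (2 ∣_) size≡ (∣m∣n⇒∣m+n (∣n⇒∣m*n |γ| (∣m⇒∣m*n |γ| 2∣m)) (m∣m*n (sum γ)))
    where
    |γ| : ℕ
    |γ| = length γ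
    rearrange : ∀ x s → x + 2 * s ≡ s + x + s
    rearrange = solve-∀
    size≡ : |γ| * (m * |γ|) + 2 * sum γ ≡ size (γ , ρ , γ)
    size≡ = trans (rearrange (|γ| * (m * |γ|)) (sum γ)) (sym size-copartition)

corollary3p4 : (a m : ℕ) → 1 ≤ a → 2 ≤ m → 2 ∣ m →
    (n k : ℕ) → IsCp a a m (2 * n + 1) k → 2 ∣ k
corollary3p4 a m _ _ 2∣m n k (L , unique , L≡cps , |L|≡k) =
  subst (2 ∣_) |L|≡k (fixedPointFreeInvolution⇒even-length unique swap-on-L)
  where
  cp : ∀ {x} → x ∈ L → IsCopartition a a m x
  cp x∈L = proj₁ (Equivalence.to (L≡cps _) x∈L)

  size≡2n+1 : ∀ {x} → x ∈ L → size x ≡ 2 * n + 1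
  size≡2n+1 x∈L = proj₂ (Equivalence.to (L≡cps _) x∈L)

  swap-on-L : IsFixedPointFreeInvolutionOn (swap m) L
  swap-on-L = record
    { closed         = λ x∈L → Equivalence.from (L≡cps _)
                         (swap-copartition (cp x∈L) , trans (size-swap (cp x∈L)) (size≡2n+1 x∈L))
    ; involutive     = λ x∈L → swap-involutive (cp x∈L)
    ; fixedPointFree = λ x∈L fixed →
        ¬2∣2n+1 n (subst (2 ∣_) (size≡2n+1 x∈L) (swap-fixed⇒even-size (cp x∈L) 2∣m fixed))
    }
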